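{- Let $m \ge 0$, $l = 2m+1$, and let $k$ be an integer with $0 \le k < l$. Then the set of positions $(a,b)$ with $a \le b$ having nim-value $1$ in the game $W_{k,l}$ is \[ \{ (2i,2i+1) : 0 \le i \le m \} \cup \{ (l+1,l+1) \} \cup \{ (A_n+l,\, B_n+l+1) : n = \lfloor j\phi^2 \rfloor \text{ for some integer } j \ge 1 \} \cup \{ (A_n+l+1,\, B_n+l+2) : n = \lfloor j\phi \rfloor \text{ for some integer } j \ge 1 \}. \]
   Context: $\phi = \frac{1+\sqrt5}{2}$, $A_n = \lfloor n\phi \rfloor$ and $B_n = \lfloor n\phi^2 \rfloor$. Positions are pairs $(a,b)$ of nonnegative integers. For integers $0 \le k \le l$, the impartial game $W_{k,l}$ (normal play: last player able to move wins) allows from $(a,b)$: a Nim move to $(a-s,b)$ or $(a,b-s)$ for any integer $s>0$ keeping coordinates nonnegative; and a diagonal move to $(a-s,b-s)$ with $s>0$, allowed only if $\min(a-s,b-s) \ge k$ and $\max(a-s,b-s) \ge l$. The nim-value (Sprague–Grundy value) of a position is the minimum excluded nonnegative integer of the set of nim-values of positions reachable in one move (terminal positions have nim-value $0$). -}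

module Defs where

open import Data.Nat using (ℕ; zero; suc; _+_; _*_; _∸_; _≤_; _<_; _⊔_; _⊓_)
open import Data.Product using (_×_; Σ; ∃; ∃-syntax; _,_)
open import Data.Sum using (_⊎_)
open import Relation.Nullary using (¬_)
open import Relation.Binary.PropositionalEquality using (_≡_; _≢_)

-- Floors of n·φ and n·φ² without reals.
-- φ = (1 + √5)/2 and φ² = (3 + √5)/2.  For p ∈ {1,3},
--   LeMul p n a  :⇔  a ≤ n·(p + √5)/2
--              ⇔  2a ≤ p·n + n·√5
--              ⇔  2a ≤ p·n  ∨  (2a − p·n)² ≤ 5·n²   (exact, all in ℕ)
LeMul : ℕ → ℕ → ℕ → Set
LeMul p n a = (2 * a ≤ p * n) ⊎ ((2 * a ∸ p * n) * (2 * a ∸ p * n) ≤ 5 * (n * n))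

-- IsFloor p n a  :⇔  a = ⌊ n·(p + √5)/2 ⌋,
-- i.e. a ≤ n(p+√5)/2 and not (a+1 ≤ n(p+√5)/2).
IsFloor : ℕ → ℕ → ℕ → Set
IsFloor p n a = LeMul p n a × ¬ LeMul p n (suc a)

-- a ≡ ⌊ n φ ⌋   (so a = A_n)
IsFloorφ : ℕ → ℕ → Set
IsFloorφ = IsFloor 1

-- b ≡ ⌊ n φ² ⌋  (so b = B_n)
IsFloorφ² : ℕ → ℕ → Set
IsFloorφ² = IsFloor 3

data Move (k l : ℕ) : ℕ → ℕ → ℕ → ℕ → Set where
  nimA : ∀ {a b a'} → a' < a → Move k l a b a' b
  nimB : ∀ {a b b'} → b' < b → Move k l a b a b'
  diag : ∀ {a' b'} (s : ℕ) → 0 < s →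
         k ≤ a' ⊓ b' → l ≤ a' ⊔ b' →
         Move k l (a' + s) (b' + s) a' b'

-- g is the Sprague–Grundy (nim-value) function of W_{k,l}:
-- g a b is the minimum excluded value of {g a' b' | (a,b) → (a',b')}.
-- (Since the game is well-founded, exactly one such g exists.)
IsNimValue : ℕ → ℕ → (ℕ → ℕ → ℕ) → Set
IsNimValue k l g =
  ∀ a b →
    (∀ a' b' → Move k l a b a' b' → g a' b' ≢ g a b) ×
    (∀ u → u < g a b → ∃[ a' ] ∃[ b' ] (Move k l a b a' b' × g a' b' ≡ u))

InP1Set : (m : ℕ) → ℕ → ℕ → Set
InP1Set m a b =
    (∃[ i ] (i ≤ m × a ≡ 2 * i × b ≡ 2 * i + 1))
  ⊎ (a ≡ l + 1 × b ≡ l + 1)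
  ⊎ (∃[ j ] ∃[ n ] ∃[ x ] ∃[ y ]
       (1 ≤ j × IsFloorφ² j n × IsFloorφ n x × IsFloorφ² n y
        × a ≡ x + l × b ≡ y + l + 1))
  ⊎ (∃[ j ] ∃[ n ] ∃[ x ] ∃[ y ]
       (1 ≤ j × IsFloorφ j n × IsFloorφ n x × IsFloorφ² n y
        × a ≡ x + l + 1 × b ≡ y + l + 2))
  where
  l : ℕ
  l = 2 * m + 1

module Submission where

open import Defs
open import Data.Nat using (ℕ; _+_; _*_; _≤_; _<_)
open import Relation.Binary.PropositionalEquality using (_≡_)
open import Function.Bundles using (_⇔_)

open import Data.Nat
open import Data.Nat.Properties
open import Data.Nat.Induction using (<-rec)
open import Data.Nat.Tactic.RingSolver using (solve-∀)
open import Data.Product using (∃-syntax; _×_; _,_; proj₁; proj₂)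
open import Data.Sum using (_⊎_; inj₁; inj₂)
open import Data.Empty using (⊥; ⊥-elim)
open import Relation.Nullary using (¬_; Dec; yes; no)
open import Relation.Binary.PropositionalEquality
open import Relation.Binary.Definitions using (tri<; tri≈; tri>)
open import Function.Base using (_∘_)
open import Function.Bundles using (mk⇔; Equivalence)
open import Function.Construct.Composition using (_⇔-∘_)

-- Without real numbers, x is compared with φn through x² ≤ xn + n²; irrationality of √5
-- (an infinite descent) makes these comparisons strict.  A n = ⌊nφ⌋ is computed step by
-- step (it grows by 1 or 2) and B n = A n + n = ⌊nφ²⌋.  From this we derive the Beatty
-- facts used later: A and B are injective, their values are disjoint and cover all c ≥ 1,
-- and A grows by 2 right after a value of A, by 1 right after a value of B; then the floor
-- predicates of Defs are identified with A and B.
--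
-- The game part rests on a level-set lemma for mex functions: S is exactly the set of
-- positions of value v when no move stays inside S, values on S are ≥ v, and every other
-- position of value ≥ v moves into S.  Independence of a symmetric set follows from its
-- ordered part being "scattered" (no shared coordinate, no shared diagonal above l), a
-- property preserved by unions of separated pieces; the Wythoff pairs translated by c are
-- scattered and dominate the region above c.

drop≤ : ∀ {P Q K L R} → P + K ≡ L → Q + K ≡ R → L ≤ R → P ≤ Q
drop≤ {P} {Q} {K} refl refl = +-cancelʳ-≤ K P Q

add≤ : ∀ {P Q K L R} → P + K ≡ L → Q + K ≡ R → P ≤ Q → L ≤ R
add≤ {K = K} refl refl = +-monoˡ-≤ K

drop< : ∀ {P Q K L R} → P + K ≡ L → Q + K ≡ R → L < R → P < Q
drop< {P} {Q} {K} refl refl = +-cancelʳ-< K P Q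

add< : ∀ {P Q K L R} → P + K ≡ L → Q + K ≡ R → P < Q → L < R
add< {K = K} refl refl = +-monoˡ-< K

drop≡ : ∀ {P Q K L R} → P + K ≡ L → Q + K ≡ R → L ≡ R → P ≡ Q
drop≡ {P} {Q} {K} refl refl = +-cancelʳ-≡ K P Q

-- Comparing x with φ·n without reals: φ is the positive root of t² = t + 1,
-- so x ≤ φn holds exactly when x² ≤ xn + n².
infix 4 _≤φ_ _<φ_ _≥φ_ _>φ_ _≤φ?_

_≤φ_ _<φ_ _≥φ_ _>φ_ : ℕ → ℕ → Set
x ≤φ n = x * x ≤ x * n + n * n
x <φ n = x * x < x * n + n * n
x ≥φ n = x * n + n * n ≤ x * x
x >φ n = x * n + n * n < x * x

_≤φ?_ : ∀ x n → Dec (x ≤φ n)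
x ≤φ? n = x * x ≤? x * n + n * n

-- Shifting by n: n + t ≤ φn  iff  tφ ≤ n, because φn − n = n/φ.
shift-identityˡ : ∀ n t → (n * t + t * t) + (n * n + n * t) ≡ (n + t) * (n + t)
shift-identityˡ = solve-∀

shift-identityʳ : ∀ n t → n * n + (n * n + n * t) ≡ (n + t) * n + n * n
shift-identityʳ = solve-∀

shift-≤ : ∀ n t → n + t ≤φ n → n ≥φ t
shift-≤ n t = drop≤ (shift-identityˡ n t) (shift-identityʳ n t)

shift-≤⁻ : ∀ n t → n ≥φ t → n + t ≤φ n
shift-≤⁻ n t = add≤ (shift-identityˡ n t) (shift-identityʳ n t)

shift-> : ∀ n t → n + t >φ n → n <φ t
shift-> n t = drop< (shift-identityʳ n t) (shift-identityˡ n t)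

shift->⁻ : ∀ n t → n <φ t → n + t >φ n
shift->⁻ n t = add< (shift-identityʳ n t) (shift-identityˡ n t)

square-pos : ∀ {n} → 0 < n → 0 < n * n
square-pos {suc n} _ = z<s

-- √5 is irrational: x² = xn + n² forces n = 0.  Infinite descent, since a
-- solution (n + c, n) with n > 0 yields the smaller solution (n, c).
irrational : ∀ n x → x * x ≡ x * n + n * n → n ≡ 0
irrational = <-rec (λ n → ∀ x → x * x ≡ x * n + n * n → n ≡ 0) descent
  where
  descent : ∀ n → (∀ {c} → c < n → ∀ x → x * x ≡ x * c + c * c → c ≡ 0) →
            ∀ x → x * x ≡ x * n + n * n → n ≡ 0
  descent zero _ _ _ = refl
  descent n@(suc _) smaller x eq with x ≤? n
  ... | yes x≤n = ⊥-elim (<-irrefl eq (≤-<-trans (*-monoʳ-≤ x x≤n) (m<m+n (x * n) (square-pos {n} z<s))))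
  ... | no x≰n with m≤n⇒∃[o]m+o≡n (<⇒≤ (≰⇒> x≰n))
  ...   | c , refl = ⊥-elim (c≢0 (smaller c<n n (sym eq′)))
    where
    eq′ : n * c + c * c ≡ n * n
    eq′ = drop≡ (shift-identityˡ n c) (shift-identityʳ n c) eq
    c≢0 : c ≢ 0
    c≢0 refl = <-irrefl (sym (trans (sym eq′) (trans (+-identityʳ (n * 0)) (*-zeroʳ n)))) (square-pos {n} z<s)
    c<n : c < n
    c<n with c <? n
    ... | yes c<n = c<n
    ... | no c≮n = ⊥-elim (<-irrefl (sym eq′) (≤-<-trans (*-monoʳ-≤ n n≤c) (m<m+n (n * c) (square-pos 0<c))))
      where
      n≤c : n ≤ c
      n≤c = ≮⇒≥ c≮n
      0<c : 0 < c
      0<c = <-≤-trans z<s n≤c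

-- By irrationality, comparisons with φn (n > 0) are never equalities.
≤φ⇒<φ : ∀ {x n} → 1 ≤ n → x ≤φ n → x <φ n
≤φ⇒<φ {x} {n} n>0 le = ≤∧≢⇒< le (λ eq → <⇒≢ n>0 (sym (irrational n x eq)))

≥φ⇒>φ : ∀ {x n} → 1 ≤ n → x ≥φ n → x >φ n
≥φ⇒>φ {x} {n} n>0 ge = ≤∧≢⇒< ge (λ eq → <⇒≢ n>0 (sym (irrational n x (sym eq))))

>φ⇒≰φ : ∀ {x n} → x >φ n → ¬ x ≤φ n
>φ⇒≰φ = <⇒≱

≤⇒≤φ : ∀ {x n} → x ≤ n → x ≤φ n
≤⇒≤φ {x} {n} x≤n = ≤-trans (*-monoʳ-≤ x x≤n) (m≤m+n (x * n) (n * n))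

>φ⇒> : ∀ {x n} → x >φ n → n < x
>φ⇒> {x} {n} gt = ≰⇒> (λ x≤n → >φ⇒≰φ {x} {n} gt (≤⇒≤φ x≤n))

≥φ⇒≥ : ∀ {n f} → n ≥φ f → f ≤ n
≥φ⇒≥ {n} {f} ge with f ≤? n
... | yes f≤n = f≤n
... | no f≰n = ⊥-elim (<⇒≱ (≤-<-trans (m≤n+m (n * n) (n * f))
                  (+-monoʳ-< (n * f) (*-mono-< (≰⇒> f≰n) (≰⇒> f≰n)))) ge)

≤φ-upward : ∀ {x n n′} → n ≤ n′ → x ≤φ n → x ≤φ n′
≤φ-upward {x} n≤n′ le = ≤-trans le (+-mono-≤ (*-monoʳ-≤ x n≤n′) (*-mono-≤ n≤n′ n≤n′))

≤φ-downward : ∀ {x y n} → y ≤ x → x ≤φ n → y ≤φ n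
≤φ-downward {x} {y} {n} y≤x le with y ≤? n
... | yes y≤n = ≤⇒≤φ y≤n
... | no y≰n with m≤n⇒∃[o]m+o≡n (<⇒≤ (≰⇒> y≰n)) | m≤n⇒∃[o]m+o≡n (≤-trans (<⇒≤ (≰⇒> y≰n)) y≤x)
...   | e , refl | f , refl = shift-≤⁻ n e (≤-trans (+-mono-≤ (*-monoʳ-≤ n e≤f) (*-mono-≤ e≤f e≤f)) (shift-≤ n f le))
  where
  e≤f : e ≤ f
  e≤f = +-cancelˡ-≤ n e f y≤x

>φ-≤φ⇒< : ∀ {x p q} → x >φ p → x ≤φ q → p < q
>φ-≤φ⇒< {x} {p} gt le = ≰⇒> (λ q≤p → >φ⇒≰φ {x} {p} gt (≤φ-upward {x} q≤p le))

-- Stepping both sides by one: x ≤ φn implies x + 1 ≤ φ(n + 1), as φ ≥ 1.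
≤φ-suc : ∀ {x n} → x ≤φ n → suc x ≤φ suc n
≤φ-suc {x} {n} le with x ≤? n
... | yes x≤n = ≤⇒≤φ (s≤s x≤n)
... | no x≰n with m≤n⇒∃[o]m+o≡n (<⇒≤ (≰⇒> x≰n))
...   | f , refl = shift-≤⁻ (suc n) f (subst₂ _≤_ (sym (expand-left n f)) (sym (expand-right n))
                     (+-mono-≤ n≥φf (≤-trans (≥φ⇒≥ n≥φf) (m≤m+n n (1 + n)))))
  where
  n≥φf : n ≥φ f
  n≥φf = shift-≤ n f le
  expand-left : ∀ n f → (1 + n) * f + f * f ≡ (n * f + f * f) + f
  expand-left = solve-∀
  expand-right : ∀ n → (1 + n) * (1 + n) ≡ n * n + (n + (1 + n))
  expand-right = solve-∀

<φ-suc : ∀ {x n} → x <φ n → suc x <φ suc n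
<φ-suc {x} {n} lt = ≤φ⇒<φ {suc x} {suc n} z<s (≤φ-suc {x} {n} (<⇒≤ lt))

-- x > φn implies x + 2 > φ(n + 1), as φ < 2.
>φ-step : ∀ {x n} → x >φ n → 2 + x >φ suc n
>φ-step {x} {n} gt with m≤n⇒∃[o]m+o≡n (<⇒≤ (>φ⇒> {x} {n} gt))
... | t , refl = subst (_>φ suc n) (cong suc (+-suc n t))
                   (shift->⁻ (suc n) (suc t) (<φ-suc {n} {t} (shift-> n t gt)))

PhiFloor : ℕ → ℕ → Set
PhiFloor n x = x ≤φ n × suc x >φ n

floor-≥ : ∀ {n x} → PhiFloor n x → n ≤ x
floor-≥ {n} {x} (_ , gt) = ≤-pred (>φ⇒> {suc x} {n} gt)

floor-max : ∀ {n x y} → PhiFloor n x → y ≤φ n → y ≤ x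
floor-max {n} {x} {y} (_ , gt) le = ≮⇒≥ (λ x<y → >φ⇒≰φ {suc x} {n} gt (≤φ-downward {y} x<y le))

floor-unique : ∀ {n x y} → PhiFloor n x → PhiFloor n y → x ≡ y
floor-unique {n} {x} {y} fx fy = ≤-antisym (floor-max {n} fy (proj₁ fx)) (floor-max {n} fx (proj₁ fy))

-- A n = ⌊φn⌋, computed step by step: as 1 < φ < 2, the floor grows by 1 or 2.
A : ℕ → ℕ
A zero = 0
A (suc n) with 2 + A n ≤φ? suc n
... | yes _ = 2 + A n
... | no _ = 1 + A n

-- B n = ⌊φ²n⌋ = ⌊φn⌋ + n.
B : ℕ → ℕ
B n = A n + n

A-floor : ∀ n → PhiFloor n (A n)
A-floor zero = z≤n , s≤s z≤n
A-floor (suc n) with 2 + A n ≤φ? suc n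
... | yes le = le , >φ-step {suc (A n)} {n} (proj₂ (A-floor n))
... | no ¬le = ≤φ-suc {A n} {n} (proj₁ (A-floor n)) , ≰⇒> ¬le

A-unique : ∀ {n x} → PhiFloor n x → A n ≡ x
A-unique {n} fx = floor-unique {n} (A-floor n) fx

A-step : ∀ n → A (suc n) ≡ 1 + A n ⊎ A (suc n) ≡ 2 + A n
A-step n with 2 + A n ≤φ? suc n
... | yes _ = inj₂ refl
... | no _ = inj₁ refl

A-≥ : ∀ n → n ≤ A n
A-≥ n = floor-≥ {n} (A-floor n)

A-<-suc : ∀ n → A n < A (suc n)
A-<-suc n with A-step n
... | inj₁ eq = ≤-reflexive (sym eq)
... | inj₂ eq = ≤-trans (n≤1+n (suc (A n))) (≤-reflexive (sym eq))

A-mono : ∀ {m n} → m < n → A m < A n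
A-mono {m} {suc n} (s≤s m≤n) with m≤n⇒m<n∨m≡n m≤n
... | inj₁ m<n = <-trans (A-mono m<n) (A-<-suc n)
... | inj₂ refl = A-<-suc n

A-mono-≤ : ∀ {m n} → m ≤ n → A m ≤ A n
A-mono-≤ m≤n with m≤n⇒m<n∨m≡n m≤n
... | inj₁ m<n = <⇒≤ (A-mono m<n)
... | inj₂ refl = ≤-refl

A-injective : ∀ {m n} → A m ≡ A n → m ≡ n
A-injective {m} {n} eq with <-cmp m n
... | tri< m<n _ _ = ⊥-elim (<⇒≢ (A-mono m<n) eq)
... | tri≈ _ m≡n _ = m≡n
... | tri> _ _ m>n = ⊥-elim (>⇒≢ (A-mono m>n) eq)

B-mono : ∀ {m n} → m < n → B m < B n
B-mono m<n = +-mono-< (A-mono m<n) m<n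

B-injective : ∀ {m n} → B m ≡ B n → m ≡ n
B-injective {m} {n} eq with <-cmp m n
... | tri< m<n _ _ = ⊥-elim (<⇒≢ (B-mono m<n) eq)
... | tri≈ _ m≡n _ = m≡n
... | tri> _ _ m>n = ⊥-elim (>⇒≢ (B-mono m>n) eq)

A-positive : ∀ {n} → 1 ≤ n → 1 ≤ A n
A-positive n≥1 = ≤-trans n≥1 (A-≥ _)

floor-of-floor : ∀ {j n} → PhiFloor (suc j) n → PhiFloor n (n + j)
floor-of-floor {j} {n} (le , gt) =
  shift-≤⁻ n j n≥φj ,
  subst (_>φ n) (+-suc n j) (shift->⁻ n (suc j) (≤φ⇒<φ {n} {suc j} z<s le))
  where
  n≥φj : n ≥φ j
  n≥φj = ≮⇒≥ (λ lt → >φ⇒≰φ {suc n} {suc j} gt (≤φ-suc {n} {j} (<⇒≤ lt)))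

floor-of-floor-suc : ∀ {j n} → PhiFloor (suc j) n → PhiFloor (suc n) (suc n + suc j)
floor-of-floor-suc {j} {n} (le , gt) =
  shift-≤⁻ (suc n) (suc j) (<⇒≤ gt) ,
  subst (_>φ suc n) (+-suc (suc n) (suc j))
    (shift->⁻ (suc n) (suc (suc j)) (≤φ⇒<φ {suc n} {suc (suc j)} z<s (≤φ-suc {n} {suc j} le)))

jump-in-range : ∀ n → A (suc n) ≡ 2 + A n → ∃[ i ] PhiFloor i n
jump-in-range n jump with m≤n⇒∃[o]m+o≡n (A-≥ n)
... | t , An≡n+t = suc t , <⇒≤ n<φ1+t , ≥φ⇒>φ {suc n} {suc t} z<s
                     (shift-≤ (suc n) (suc t) (≤φ-downward {A (suc n)} (≤-reflexive (sym reach)) (proj₁ (A-floor (suc n)))))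
  where
  n<φ1+t : n <φ suc t
  n<φ1+t = shift-> n (suc t) (subst (_>φ n) (trans (cong suc (sym An≡n+t)) (sym (+-suc n t))) (proj₂ (A-floor n)))
  reach : A (suc n) ≡ suc n + suc t
  reach = trans jump (trans (cong (2 +_) (sym An≡n+t)) (cong suc (sym (+-suc n t))))

A≢B : ∀ {n n′} → 1 ≤ n′ → A n ≢ B n′
A≢B {n} {n′} n′≥1 eq = <⇒≱ a<n (≤-pred n<1+a)
  where
  a : ℕ
  a = A n′
  fa : PhiFloor n′ a
  fa = A-floor n′
  fn : PhiFloor n (a + n′)
  fn = subst (PhiFloor n) eq (A-floor n)
  a<n : a < n
  a<n = >φ-≤φ⇒< {a + n′} (shift->⁻ a n′ (≤φ⇒<φ {a} {n′} n′≥1 (proj₁ fa))) (proj₁ fn)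
  n<1+a : n < suc a
  n<1+a = >φ-≤φ⇒< {suc a + n′} (proj₂ fn) (shift-≤⁻ (suc a) n′ (<⇒≤ (proj₂ fa)))

straddle : ∀ N c → 1 ≤ c → c ≤ A N → ∃[ n ] A n < c × c ≤ A (suc n)
straddle zero c c≥1 c≤0 = ⊥-elim (<⇒≱ c≥1 c≤0)
straddle (suc N) c c≥1 c≤ with c ≤? A N
... | yes c≤′ = straddle N c c≥1 c≤′
... | no c≰ = N , ≰⇒> c≰ , c≤

jump-skips-B : ∀ n → A (suc n) ≡ 2 + A n → ∃[ j ] 1 ≤ j × B j ≡ suc (A n)
jump-skips-B n jump with jump-in-range n jump
... | zero , f0 with A-unique {0} {n} f0
...   | refl = ⊥-elim (A1≢2 jump)
  where
  A1≢2 : A 1 ≢ 2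
  A1≢2 ()
jump-skips-B n jump | suc j , fj = suc j , s≤s z≤n , (begin
  A (suc j) + suc j  ≡⟨ cong (_+ suc j) (A-unique fj) ⟩
  n + suc j          ≡⟨ +-suc n j ⟩
  suc (n + j)        ≡⟨ cong suc (sym (A-unique {n} (floor-of-floor {j} {n} fj))) ⟩
  suc (A n)          ∎)
  where open ≡-Reasoning

complement : ∀ c → 1 ≤ c → (∃[ n ] 1 ≤ n × A n ≡ c) ⊎ (∃[ n ] 1 ≤ n × B n ≡ c)
complement c c≥1 with straddle c c c≥1 (A-≥ c)
... | n , An<c , c≤ with m≤n⇒m<n∨m≡n c≤
...   | inj₂ c≡ = inj₁ (suc n , s≤s z≤n , sym c≡)
...   | inj₁ c< with A-step n
...     | inj₁ step = ⊥-elim (<⇒≱ An<c (≤-pred (subst (c <_) step c<)))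
...     | inj₂ jump with jump-skips-B n jump
...       | j , j≥1 , Bj≡ = inj₂ (j , j≥1 , trans Bj≡ (≤-antisym An<c (≤-pred (subst (c <_) jump c<))))

A-after-A : ∀ {j} → 1 ≤ j → A (suc (A j)) ≡ 2 + A (A j)
A-after-A {suc j} _ = begin
  A (suc n)          ≡⟨ A-unique (floor-of-floor-suc (A-floor (suc j))) ⟩
  suc n + suc j      ≡⟨ cong suc (+-suc n j) ⟩
  2 + (n + j)        ≡⟨ cong (2 +_) (sym (A-unique {n} (floor-of-floor {j} {n} (A-floor (suc j))))) ⟩
  2 + A n            ∎
  where
  open ≡-Reasoning
  n : ℕ
  n = A (suc j)

A-after-B : ∀ {j} → 1 ≤ j → A (suc (B j)) ≡ 1 + A (B j)
A-after-B {j} j≥1 with A-step (B j)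
... | inj₁ step = step
... | inj₂ jump with jump-in-range (B j) jump
...   | i , fi = ⊥-elim (A≢B {i} j≥1 (A-unique {i} fi))

scale-square : ∀ a → (2 * a) * (2 * a) ≡ 4 * (a * a)
scale-square = solve-∀

scale-form : ∀ a n → (2 * a) * (2 * n) + (2 * n) * (2 * n) ≡ 4 * (a * n + n * n)
scale-form = solve-∀

≤φ-halve : ∀ {a n} → 2 * a ≤φ 2 * n → a ≤φ n
≤φ-halve {a} {n} = *-cancelˡ-≤ 4 ∘ subst₂ _≤_ (scale-square a) (scale-form a n)

≤φ-double : ∀ {a n} → a ≤φ n → 2 * a ≤φ 2 * n
≤φ-double {a} {n} = subst₂ _≤_ (sym (scale-square a)) (sym (scale-form a n)) ∘ *-monoʳ-≤ 4

-- With 2a = n + X:  (2a)² ≤ 2a·2n + (2n)²  iff  X² ≤ 5n²  (common summand n² + 2nX).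
square-identityˡ : ∀ n X → X * X + (n * n + 2 * (n * X)) ≡ (1 * n + X) * (1 * n + X)
square-identityˡ = solve-∀

square-identityʳ : ∀ n X → 5 * (n * n) + (n * n + 2 * (n * X)) ≡ (1 * n + X) * (2 * n) + (2 * n) * (2 * n)
square-identityʳ = solve-∀

excess⇔≤φ : ∀ {n a} → 1 * n < 2 * a → (2 * a ∸ 1 * n) * (2 * a ∸ 1 * n) ≤ 5 * (n * n) ⇔ 2 * a ≤φ 2 * n
excess⇔≤φ {n} {a} n<2a with m≤n⇒∃[o]m+o≡n (<⇒≤ n<2a)
... | X , n+X≡2a = mk⇔
  (λ sq → subst (_≤φ 2 * n) n+X≡2a (add≤ (square-identityˡ n X) (square-identityʳ n X) (subst Bounded X≡ sq)))
  (λ le → subst Bounded (sym X≡) (drop≤ (square-identityˡ n X) (square-identityʳ n X) (subst (_≤φ 2 * n) (sym n+X≡2a) le)))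
  where
  Bounded : ℕ → Set
  Bounded z = z * z ≤ 5 * (n * n)
  X≡ : 2 * a ∸ 1 * n ≡ X
  X≡ = trans (cong (_∸ 1 * n) (sym n+X≡2a)) (m+n∸m≡n (1 * n) X)

half≤ : ∀ {a n} → 2 * a ≤ 1 * n → a ≤ n
half≤ {a} {n} h = ≤-trans (m≤m+n a (a + 0)) (≤-trans h (≤-reflexive (*-identityˡ n)))

LeMul₁⇒≤φ : ∀ {n a} → LeMul 1 n a → a ≤φ n
LeMul₁⇒≤φ {n} {a} (inj₁ 2a≤n) = ≤⇒≤φ {a} {n} (half≤ 2a≤n)
LeMul₁⇒≤φ {n} {a} (inj₂ sq) with 2 * a ≤? 1 * n
... | yes 2a≤n = ≤⇒≤φ {a} {n} (half≤ 2a≤n)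
... | no 2a≰n = ≤φ-halve {a} {n} (Equivalence.to (excess⇔≤φ {n} {a} (≰⇒> 2a≰n)) sq)

≤φ⇒LeMul₁ : ∀ {n a} → a ≤φ n → LeMul 1 n a
≤φ⇒LeMul₁ {n} {a} le with 2 * a ≤? 1 * n
... | yes 2a≤n = inj₁ 2a≤n
... | no 2a≰n = inj₂ (Equivalence.from (excess⇔≤φ {n} {a} (≰⇒> 2a≰n)) (≤φ-double {a} {n} le))

-- Since φ² = φ + 1:  n + b ≤ φ²n  iff  b ≤ φn, in Defs' encoding.
linear-shift : ∀ n b → 2 * b + 2 * n ≡ 2 * (n + b)
linear-shift = solve-∀

three-split : ∀ n → 1 * n + 2 * n ≡ 3 * n
three-split = solve-∀

excess-shift : ∀ n b → 2 * (n + b) ∸ 3 * n ≡ 2 * b ∸ 1 * n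
excess-shift n b = begin
  2 * (n + b) ∸ 3 * n             ≡⟨ cong₂ _∸_ (*-distribˡ-+ 2 n b) (trans (sym (three-split n)) (+-comm (1 * n) (2 * n))) ⟩
  (2 * n + 2 * b) ∸ (2 * n + 1 * n) ≡⟨ [m+n]∸[m+o]≡n∸o (2 * n) (2 * b) (1 * n) ⟩
  2 * b ∸ 1 * n                   ∎
  where open ≡-Reasoning

LeMul₃⇒LeMul₁ : ∀ {n b} → LeMul 3 n (n + b) → LeMul 1 n b
LeMul₃⇒LeMul₁ {n} {b} (inj₁ le) = inj₁ (drop≤ (linear-shift n b) (three-split n) le)
LeMul₃⇒LeMul₁ {n} {b} (inj₂ sq) = inj₂ (subst (λ z → z * z ≤ 5 * (n * n)) (excess-shift n b) sq)

LeMul₁⇒LeMul₃ : ∀ {n b} → LeMul 1 n b → LeMul 3 n (n + b)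
LeMul₁⇒LeMul₃ {n} {b} (inj₁ le) = inj₁ (add≤ (linear-shift n b) (three-split n) le)
LeMul₁⇒LeMul₃ {n} {b} (inj₂ sq) = inj₂ (subst (λ z → z * z ≤ 5 * (n * n)) (sym (excess-shift n b)) sq)

IsFloorφ⇒PhiFloor : ∀ {n x} → IsFloorφ n x → PhiFloor n x
IsFloorφ⇒PhiFloor {n} {x} (le , ¬le) = LeMul₁⇒≤φ {n} {x} le , ≰⇒> (¬le ∘ ≤φ⇒LeMul₁ {n} {suc x})

PhiFloor⇒IsFloorφ : ∀ {n x} → PhiFloor n x → IsFloorφ n x
PhiFloor⇒IsFloorφ {n} {x} (le , gt) = ≤φ⇒LeMul₁ {n} {x} le , (>φ⇒≰φ {suc x} {n} gt ∘ LeMul₁⇒≤φ)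

IsFloorφ⇒≡A : ∀ {n x} → IsFloorφ n x → x ≡ A n
IsFloorφ⇒≡A {n} fx = sym (A-unique {n} (IsFloorφ⇒PhiFloor fx))

IsFloorφ-A : ∀ n → IsFloorφ n (A n)
IsFloorφ-A n = PhiFloor⇒IsFloorφ {n} (A-floor n)

IsFloorφ²⇒≥ : ∀ {n y} → IsFloorφ² n y → n ≤ y
IsFloorφ²⇒≥ {n} {y} (_ , ¬le) = ≮⇒≥ (λ y<n → ¬le (inj₁ (≤-trans (*-monoʳ-≤ 2 y<n) (*-monoˡ-≤ n (n≤1+n 2)))))

IsFloorφ²-shift : ∀ {n b} → IsFloorφ² n (n + b) → IsFloorφ n b
IsFloorφ²-shift {n} {b} (le , ¬le) = LeMul₃⇒LeMul₁ le , (¬le ∘ subst (LeMul 3 n) (+-suc n b) ∘ LeMul₁⇒LeMul₃)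

IsFloorφ²⇒≡B : ∀ {n y} → IsFloorφ² n y → y ≡ B n
IsFloorφ²⇒≡B {n} {y} fy with m≤n⇒∃[o]m+o≡n (IsFloorφ²⇒≥ {n} fy)
... | b , refl = trans (+-comm n b) (cong (_+ n) (IsFloorφ⇒≡A (IsFloorφ²-shift fy)))

IsFloorφ²-B : ∀ n → IsFloorφ² n (B n)
IsFloorφ²-B n = subst (IsFloorφ² n) (+-comm n (A n))
  (LeMul₁⇒LeMul₃ le , (¬le ∘ LeMul₃⇒LeMul₁ ∘ subst (LeMul 3 n) (sym (+-suc n (A n)))))
  where
  le : LeMul 1 n (A n)
  le = proj₁ (IsFloorφ-A n)
  ¬le : ¬ LeMul 1 n (suc (A n))
  ¬le = proj₂ (IsFloorφ-A n)

Reach : (ℕ → ℕ → ℕ → ℕ → Set) → (ℕ → ℕ → Set) → ℕ → ℕ → Set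
Reach Mv S a b = ∃[ a′ ] ∃[ b′ ] (Mv a b a′ b′ × S a′ b′)

rank-induction : (P : ℕ → ℕ → Set) → (∀ a b → (∀ a′ b′ → a′ + b′ < a + b → P a′ b′) → P a b) → ∀ a b → P a b
rank-induction P step a b = <-rec (λ N → ∀ a b → a + b ≡ N → P a b)
  (λ N smaller a b a+b≡N → step a b (λ a′ b′ lt → smaller (subst (a′ + b′ <_) a+b≡N lt) a′ b′ refl))
  (a + b) a b refl

module LevelSet (Mv : ℕ → ℕ → ℕ → ℕ → Set)
  (shrinks : ∀ {a b a′ b′} → Mv a b a′ b′ → a′ + b′ < a + b)
  (g : ℕ → ℕ → ℕ)
  (mex : ∀ a b → (∀ a′ b′ → Mv a b a′ b′ → g a′ b′ ≢ g a b) ×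
                 (∀ u → u < g a b → ∃[ a′ ] ∃[ b′ ] (Mv a b a′ b′ × g a′ b′ ≡ u)))
  where

  level-set : ∀ v (S : ℕ → ℕ → Set) →
    (∀ {a b a′ b′} → Mv a b a′ b′ → S a b → S a′ b′ → ⊥) →
    (∀ {a b} → S a b → v ≤ g a b) →
    (∀ a b → S a b ⊎ g a b < v ⊎ Reach Mv S a b) →
    ∀ a b → g a b ≡ v ⇔ S a b
  level-set v S independent at-least dominated a b = mk⇔ (proj₁ (both a b)) (proj₂ (both a b))
    where
    Claim : ℕ → ℕ → Set
    Claim a b = (g a b ≡ v → S a b) × (S a b → g a b ≡ v)

    both : ∀ a b → Claim a b
    both = rank-induction Claim step
      where
      step : ∀ a b → (∀ a′ b′ → a′ + b′ < a + b → Claim a′ b′) → Claim a b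
      step a b ih = value⇒S , S⇒value
        where
        -- A position of value v cannot move to one of S, which has value v too.
        value⇒S : g a b ≡ v → S a b
        value⇒S gv with dominated a b
        ... | inj₁ s = s
        ... | inj₂ (inj₁ g<v) = ⊥-elim (<⇒≢ g<v gv)
        ... | inj₂ (inj₂ (a′ , b′ , mv , s′)) =
          ⊥-elim (proj₁ (mex a b) a′ b′ mv (trans (proj₂ (ih a′ b′ (shrinks mv)) s′) (sym gv)))
        -- A larger value would give a move to a position of value v, i.e. inside S.
        S⇒value : S a b → g a b ≡ v
        S⇒value s = ≤-antisym (≮⇒≥ too-large) (at-least s)
          where
          too-large : v < g a b → ⊥
          too-large v<g with proj₂ (mex a b) v v<g
          ... | a′ , b′ , mv , gv′ = independent mv s (proj₁ (ih a′ b′ (shrinks mv)) gv′)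

move-shrinks : ∀ {k L a b a′ b′} → Move k L a b a′ b′ → a′ + b′ < a + b
move-shrinks {b = b} (nimA a′<a) = +-monoˡ-< b a′<a
move-shrinks {a = a} (nimB b′<b) = +-monoʳ-< a b′<b
move-shrinks (diag {a′} {b′} s s>0 _ _) = subst (a′ + b′ <_) (sym (regroup a′ b′ s)) (m<m+n (a′ + b′) (+-mono-< s>0 s>0))
  where
  regroup : ∀ a′ b′ s → (a′ + s) + (b′ + s) ≡ a′ + b′ + (s + s)
  regroup = solve-∀

move-swap : ∀ {k L a b a′ b′} → Move k L a b a′ b′ → Move k L b a b′ a′
move-swap (nimA lt) = nimB lt
move-swap (nimB lt) = nimA lt
move-swap {k} {L} (diag {a′} {b′} s s>0 k≤ L≤) = diag s s>0 (subst (k ≤_) (⊓-comm a′ b′) k≤) (subst (L ≤_) (⊔-comm a′ b′) L≤)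

diagonal-move : ∀ {k L a b a′ b′} s → a ≡ a′ + s → b ≡ b′ + s → 0 < s → k ≤ a′ ⊓ b′ → L ≤ a′ ⊔ b′ → Move k L a b a′ b′
diagonal-move s refl refl = diag s

-- Sets of positions, given by their part with a ≤ b and closed up under swapping.
_∪_ : (U V : ℕ → ℕ → Set) → ℕ → ℕ → Set
(U ∪ V) a b = U a b ⊎ V a b

Sym : (ℕ → ℕ → Set) → ℕ → ℕ → Set
Sym U a b = U a b ⊎ U b a

Sym-swap : ∀ {U a b} → Sym U a b → Sym U b a
Sym-swap (inj₁ u) = inj₂ u
Sym-swap (inj₂ u) = inj₁ u

Sym-map : ∀ {U V : ℕ → ℕ → Set} → (∀ {a b} → U a b → V a b) → ∀ {a b} → Sym U a b → Sym V a b
Sym-map f (inj₁ u) = inj₁ (f u)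
Sym-map f (inj₂ u) = inj₂ (f u)

Reach-map : ∀ {Mv} {U V : ℕ → ℕ → Set} → (∀ {a b} → U a b → V a b) → ∀ {a b} → Reach Mv U a b → Reach Mv V a b
Reach-map f (a′ , b′ , mv , u) = a′ , b′ , mv , f u

Reach-swap : ∀ {k L U a b} → Reach (Move k L) (Sym U) a b → Reach (Move k L) (Sym U) b a
Reach-swap {U = U} (a′ , b′ , mv , u) = b′ , a′ , move-swap mv , Sym-swap {U} u

Dominated : (k L : ℕ) (U X : ℕ → ℕ → Set) → ℕ → ℕ → Set
Dominated k L U X a b = Sym U a b ⊎ X a b ⊎ Reach (Move k L) (Sym U) a b

dominated-everywhere : ∀ {k L U X} → (∀ {a b} → X a b → X b a) →
  (∀ {a b} → a ≤ b → Dominated k L U X a b) → ∀ a b → Dominated k L U X a b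
dominated-everywhere {U = U} X-swap upper a b with ≤-total a b
... | inj₁ a≤b = upper a≤b
... | inj₂ b≤a with upper b≤a
...   | inj₁ u = inj₁ (Sym-swap {U} u)
...   | inj₂ (inj₁ x) = inj₂ (inj₁ (X-swap x))
...   | inj₂ (inj₂ r) = inj₂ (inj₂ (Reach-swap {U = U} r))

-- A set U of positions with a ≤ b is scattered (for diagonal threshold L) when no two of its
-- positions share a coordinate and no two lie on a common diagonal above the threshold:
-- then no move of W_{k,L} joins two positions of Sym U.
record Scattered (L : ℕ) (U : ℕ → ℕ → Set) : Set where
  field
    ordered     : ∀ {a b} → U a b → a ≤ b
    same-lower  : ∀ {a b b′} → U a b → U a b′ → b ≡ b′
    same-upper  : ∀ {a a′ b} → U a b → U a′ b → a ≡ a′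
    lower-upper : ∀ {a b b′} → U a b → U b′ a → b ≡ b′
    same-offset : ∀ {a b s} → U a b → U (a + s) (b + s) → L ≤ a ⊔ b → s ≡ 0

module _ {L : ℕ} {U : ℕ → ℕ → Set} (scattered : Scattered L U) where
  open Scattered scattered

  Sym-row : ∀ {a b b′} → Sym U a b → Sym U a b′ → b ≡ b′
  Sym-row (inj₁ u) (inj₁ u′) = same-lower u u′
  Sym-row (inj₁ u) (inj₂ u′) = lower-upper u u′
  Sym-row (inj₂ u) (inj₁ u′) = sym (lower-upper u′ u)
  Sym-row (inj₂ u) (inj₂ u′) = same-upper u u′

  Sym-column : ∀ {a a′ b} → Sym U a b → Sym U a′ b → a ≡ a′
  Sym-column u u′ = Sym-row (Sym-swap {U} u) (Sym-swap {U} u′)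

  -- Positions of U met in both orientations lie on the main diagonal.
  Sym-offset : ∀ {a b s} → Sym U a b → Sym U (a + s) (b + s) → L ≤ a ⊔ b → s ≡ 0
  Sym-offset (inj₁ u) (inj₁ u′) L≤ = same-offset u u′ L≤
  Sym-offset {a} {b} (inj₂ u) (inj₂ u′) L≤ = same-offset u u′ (subst (L ≤_) (⊔-comm a b) L≤)
  Sym-offset {a} {b} {s} (inj₁ u) (inj₂ u′) L≤ with ≤-antisym (ordered u) (+-cancelʳ-≤ s b a (ordered u′))
  ... | refl = same-offset u u′ L≤
  Sym-offset {a} {b} {s} (inj₂ u) (inj₁ u′) L≤ with ≤-antisym (+-cancelʳ-≤ s a b (ordered u′)) (ordered u)
  ... | refl = same-offset u u′ L≤

  independent : ∀ {k a b a′ b′} → Move k L a b a′ b′ → Sym U a b → Sym U a′ b′ → ⊥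
  independent (nimA a′<a) u u′ = <⇒≢ a′<a (Sym-column u′ u)
  independent (nimB b′<b) u u′ = <⇒≢ b′<b (Sym-row u′ u)
  independent (diag s s>0 _ L≤) u u′ = >⇒≢ s>0 (Sym-offset u′ u L≤)

Scattered-∪ : ∀ {L U V} → Scattered L U → Scattered L V →
  (∀ {a b a′ b′} → U a b → V a′ b′ → b < a′) →
  (∀ {a b s} → U a b → V (a + s) (b + s) → ⊥) →
  Scattered L (U ∪ V)
Scattered-∪ {L} {U} {V} scU scV below offsets = record
  { ordered = λ { (inj₁ u) → U.ordered u ; (inj₂ v) → V.ordered v }
  ; same-lower = same-lower
  ; same-upper = same-upper
  ; lower-upper = lower-upper
  ; same-offset = same-offset
  }
  where
  module U = Scattered scU
  module V = Scattered scV

  same-lower : ∀ {a b b′} → (U ∪ V) a b → (U ∪ V) a b′ → b ≡ b′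
  same-lower (inj₁ u) (inj₁ u′) = U.same-lower u u′
  same-lower (inj₁ u) (inj₂ v) = ⊥-elim (<⇒≱ (below u v) (U.ordered u))
  same-lower (inj₂ v) (inj₁ u) = ⊥-elim (<⇒≱ (below u v) (U.ordered u))
  same-lower (inj₂ v) (inj₂ v′) = V.same-lower v v′

  same-upper : ∀ {a a′ b} → (U ∪ V) a b → (U ∪ V) a′ b → a ≡ a′
  same-upper (inj₁ u) (inj₁ u′) = U.same-upper u u′
  same-upper (inj₁ u) (inj₂ v) = ⊥-elim (<⇒≱ (below u v) (V.ordered v))
  same-upper (inj₂ v) (inj₁ u) = ⊥-elim (<⇒≱ (below u v) (V.ordered v))
  same-upper (inj₂ v) (inj₂ v′) = V.same-upper v v′

  lower-upper : ∀ {a b b′} → (U ∪ V) a b → (U ∪ V) b′ a → b ≡ b′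
  lower-upper (inj₁ u) (inj₁ u′) = U.lower-upper u u′
  lower-upper (inj₁ u) (inj₂ v) = ⊥-elim (<⇒≱ (below u v) (≤-trans (V.ordered v) (U.ordered u)))
  lower-upper (inj₂ v) (inj₁ u) = ⊥-elim (<-irrefl refl (below u v))
  lower-upper (inj₂ v) (inj₂ v′) = V.lower-upper v v′

  same-offset : ∀ {a b s} → (U ∪ V) a b → (U ∪ V) (a + s) (b + s) → L ≤ a ⊔ b → s ≡ 0
  same-offset (inj₁ u) (inj₁ u′) L≤ = U.same-offset u u′ L≤
  same-offset (inj₁ u) (inj₂ v) _ = ⊥-elim (offsets u v)
  same-offset {a} {b} {s} (inj₂ v) (inj₁ u) _ =
    ⊥-elim (<⇒≱ (below u v) (≤-trans (V.ordered v) (m≤m+n b s)))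
  same-offset (inj₂ v) (inj₂ v′) L≤ = V.same-offset v v′ L≤

Sym-disjoint : ∀ {U V : ℕ → ℕ → Set} → (∀ {a b} → U a b → a ≤ b) → (∀ {a b} → V a b → a ≤ b) →
  (∀ {a b} → U a b → V a b → ⊥) → ∀ {a b} → Sym U a b → Sym V a b → ⊥
Sym-disjoint ordU ordV disjoint (inj₁ u) (inj₁ v) = disjoint u v
Sym-disjoint ordU ordV disjoint (inj₂ u) (inj₂ v) = disjoint u v
Sym-disjoint ordU ordV disjoint (inj₁ u) (inj₂ v) with ≤-antisym (ordU u) (ordV v)
... | refl = disjoint u v
Sym-disjoint ordU ordV disjoint (inj₂ u) (inj₁ v) with ≤-antisym (ordV v) (ordU u)
... | refl = disjoint u v

Sym-upper : ∀ {U : ℕ → ℕ → Set} → (∀ {a b} → U a b → a ≤ b) → ∀ {a b} → a ≤ b → Sym U a b → U a b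
Sym-upper ordered a≤b (inj₁ u) = u
Sym-upper ordered a≤b (inj₂ u) with ≤-antisym a≤b (ordered u)
... | refl = u

-- BeattyPair n₀ c a b :  (a, b) = (A n + c, B n + c) for some n ≥ n₀,
-- a Wythoff pair translated diagonally by c.
record BeattyPair (n₀ c a b : ℕ) : Set where
  constructor pair
  field
    index   : ℕ
    index≥  : n₀ ≤ index
    lower≡  : a ≡ A index + c
    upper≡  : b ≡ B index + c

pair-offset : ∀ {n₀ c a b} (p : BeattyPair n₀ c a b) → b ≡ a + BeattyPair.index p
pair-offset {c = c} (pair n _ refl refl) = regroup (A n) n c
  where
  regroup : ∀ x n c → x + n + c ≡ x + c + n
  regroup = solve-∀

pair-offset-≥ : ∀ {n₀ c a b d} → BeattyPair n₀ c a b → b ≡ a + d → n₀ ≤ d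
pair-offset-≥ {a = a} {d = d} p b≡ = subst (_ ≤_) (+-cancelˡ-≡ a _ d (trans (sym (pair-offset p)) b≡)) (BeattyPair.index≥ p)

pair-lower-bound : ∀ {n₀ c a b} → BeattyPair n₀ c a b → A n₀ + c ≤ a
pair-lower-bound {c = c} (pair n n≥ refl _) = +-monoˡ-≤ c (A-mono-≤ n≥)

-- Translated pairs never share a coordinate or a diagonal (A, B injective with disjoint values).
BeattyPair-scattered : ∀ {n₀ c L} → 1 ≤ n₀ → Scattered L (BeattyPair n₀ c)
BeattyPair-scattered {n₀} {c} {L} n₀≥1 = record
  { ordered = λ p → subst (_ ≤_) (sym (pair-offset p)) (m≤m+n _ _)
  ; same-lower = same-lower
  ; same-upper = same-upper
  ; lower-upper = lower-upper
  ; same-offset = same-offset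
  }
  where
  same-lower : ∀ {a b b′} → BeattyPair n₀ c a b → BeattyPair n₀ c a b′ → b ≡ b′
  same-lower (pair n _ refl refl) (pair n′ _ eq refl) with A-injective {n} {n′} (+-cancelʳ-≡ c _ _ eq)
  ... | refl = refl

  same-upper : ∀ {a a′ b} → BeattyPair n₀ c a b → BeattyPair n₀ c a′ b → a ≡ a′
  same-upper (pair n _ refl refl) (pair n′ _ refl eq) with B-injective {n} {n′} (+-cancelʳ-≡ c _ _ eq)
  ... | refl = refl

  lower-upper : ∀ {a b b′} → BeattyPair n₀ c a b → BeattyPair n₀ c b′ a → b ≡ b′
  lower-upper (pair n _ refl _) (pair n′ n′≥ _ eq) =
    ⊥-elim (A≢B {n} {n′} (≤-trans n₀≥1 n′≥) (+-cancelʳ-≡ c _ _ eq))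

  same-offset : ∀ {a b s} → BeattyPair n₀ c a b → BeattyPair n₀ c (a + s) (b + s) → L ≤ a ⊔ b → s ≡ 0
  same-offset {a} {b} {s} p p′ _ = +-cancelˡ-≡ a s 0
    (trans (lower≡ p′) (trans (cong (λ i → A i + c) (sym same-index)) (trans (sym (lower≡ p)) (sym (+-identityʳ a)))))
    where
    open BeattyPair
    swap-last : ∀ a s n → a + s + n ≡ a + n + s
    swap-last = solve-∀
    same-index : index p ≡ index p′
    same-index = +-cancelˡ-≡ (a + s) _ _
      (trans (swap-last a s (index p)) (trans (cong (_+ s) (sym (pair-offset p))) (pair-offset p′)))

-- From (A n + c, A n + c + d) with 1 ≤ d < n, the diagonal move by A n − A d
-- reaches the translated pair of index d (allowed when k ≤ c and L ≤ c + 1).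
beatty-diagonal-move : ∀ {k L c n d} → k ≤ c → L ≤ suc c → 1 ≤ d → d < n →
  Move k L (A n + c) (A n + c + d) (A d + c) (B d + c)
beatty-diagonal-move {k} {L} {c} {n} {d} k≤c L≤1+c d≥1 d<n with m≤n⇒∃[o]m+o≡n (A-mono d<n)
... | t , Ad+t≡An = diagonal-move (suc t)
        (trans (cong (_+ c) (sym Ad+t≡An)) (move-lower (A d) t c))
        (trans (cong (λ x → x + c + d) (sym Ad+t≡An)) (move-upper (A d) t c d))
        z<s
        (⊓-glb (≤-trans k≤c (m≤n+m c (A d))) (≤-trans k≤c (m≤n+m c (B d))))
        (≤-trans (≤-trans L≤1+c (+-monoˡ-≤ c (A-positive d≥1))) (m≤m⊔n _ _))
  where
  move-lower : ∀ x t c → suc x + t + c ≡ x + c + suc t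
  move-lower = solve-∀
  move-upper : ∀ x t c d → suc x + t + c + d ≡ x + d + c + suc t
  move-upper = solve-∀

beatty-dominates : ∀ {k L n₀ c n a b} → 1 ≤ n₀ → k ≤ c → L ≤ suc c → n₀ ≤ n → a ≤ b →
  a ≡ A n + c ⊎ a ≡ B n + c →
  Sym (BeattyPair n₀ c) a b ⊎ Reach (Move k L) (Sym (BeattyPair n₀ c)) a b ⊎
  (a ≡ A n + c × ∃[ d ] (d < n₀ × b ≡ a + d))
beatty-dominates {n₀ = n₀} {c} {n} {a} {b} n₀≥1 k≤c L≤1+c n≥ a≤b (inj₂ a≡B) =
  inj₂ (inj₁ (a , A n + c , nimB (<-≤-trans A<a a≤b) , inj₂ (pair n n≥ refl a≡B)))
  where
  A<a : A n + c < a
  A<a = subst (A n + c <_) (sym a≡B) (+-monoˡ-< c (m<m+n (A n) (≤-trans n₀≥1 n≥)))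
beatty-dominates {n₀ = n₀} {c} {n} {a} {b} n₀≥1 k≤c L≤1+c n≥ a≤b (inj₁ a≡A) with <-cmp b (B n + c)
... | tri≈ _ b≡B _ = inj₁ (inj₁ (pair n n≥ a≡A b≡B))
... | tri> _ _ b>B = inj₂ (inj₁ (a , B n + c , nimB b>B , inj₁ (pair n n≥ a≡A refl)))
... | tri< b<B _ _ with m≤n⇒∃[o]m+o≡n a≤b
...   | d , refl with d <? n₀
...     | yes d<n₀ = inj₂ (inj₂ (a≡A , d , d<n₀ , refl))
...     | no d≮n₀ = inj₂ (inj₁ (A d + c , B d + c ,
            subst (λ x → Move _ _ x (x + d) (A d + c) (B d + c)) (sym a≡A)
              (beatty-diagonal-move k≤c L≤1+c (≤-trans n₀≥1 (≮⇒≥ d≮n₀)) d<n) ,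
            inj₁ (pair d (≮⇒≥ d≮n₀) refl refl)))
  where
  d<n : d < n
  d<n = +-cancelˡ-< (A n + c) d n (subst₂ _<_ (cong (_+ d) a≡A) (regroup (A n) n c) b<B)
    where
    regroup : ∀ x n c → x + n + c ≡ x + c + n
    regroup = solve-∀

-- Every a > c is A n + c or B n + c for some n ≥ 1 (complementarity of A and B).
beatty-index : ∀ {c a} → c < a → ∃[ n ] (1 ≤ n × (a ≡ A n + c ⊎ a ≡ B n + c))
beatty-index {c} {a} c<a with m≤n⇒∃[o]m+o≡n c<a
... | e , refl with complement (suc e) z<s
...   | inj₁ (n , n≥1 , An≡) = n , n≥1 , inj₁ (trans (cong suc (+-comm c e)) (cong (_+ c) (sym An≡)))
...   | inj₂ (n , n≥1 , Bn≡) = n , n≥1 , inj₂ (trans (cong suc (+-comm c e)) (cong (_+ c) (sym Bn≡)))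

Diagonal : ℕ → ℕ → ℕ → Set
Diagonal L a b = a ≡ b × a ≤ L

ZeroUpper : ℕ → ℕ → ℕ → Set
ZeroUpper L = Diagonal L ∪ BeattyPair 1 L

-- Diagonal positions differ in both coordinates; only (L, L) reaches the threshold.
Diagonal-scattered : ∀ {L} → Scattered L (Diagonal L)
Diagonal-scattered {L} = record
  { ordered = λ (a≡b , _) → ≤-reflexive a≡b
  ; same-lower = λ (a≡b , _) (a≡b′ , _) → trans (sym a≡b) a≡b′
  ; same-upper = λ (a≡b , _) (a′≡b , _) → trans a≡b (sym a′≡b)
  ; lower-upper = λ (a≡b , _) (b′≡a , _) → trans (sym a≡b) (sym b′≡a)
  ; same-offset = same-offset
  }
  where
  same-offset : ∀ {a b s} → Diagonal L a b → Diagonal L (a + s) (b + s) → L ≤ a ⊔ b → s ≡ 0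
  same-offset {a} {s = s} (refl , _) (_ , a+s≤L) L≤ =
    n≤0⇒n≡0 (+-cancelˡ-≤ a s 0 (≤-trans a+s≤L (subst (L ≤_) (trans (⊔-idem a) (sym (+-identityʳ a))) L≤)))

-- The diagonal part lies below the translated pairs, and has offset 0 < n.
ZeroUpper-scattered : ∀ {L} → Scattered L (ZeroUpper L)
ZeroUpper-scattered {L} = Scattered-∪ Diagonal-scattered (BeattyPair-scattered ≤-refl) below offsets
  where
  below : ∀ {a b a′ b′} → Diagonal L a b → BeattyPair 1 L a′ b′ → b < a′
  below (refl , a≤L) p = <-≤-trans (s≤s a≤L) (pair-lower-bound p)
  offsets : ∀ {a b s} → Diagonal L a b → BeattyPair 1 L (a + s) (b + s) → ⊥
  offsets {a} {s = s} (refl , _) p = <⇒≱ (pair-offset-≥ p (sym (+-identityʳ (a + s)))) z≤n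

-- Above L, the translated Wythoff pairs dominate; the remaining case b = a is settled by
-- the diagonal move down to (L, L).
zero-dominates-high : ∀ {k L a b n} → k ≤ L → a ≤ b → 1 ≤ n → a ≡ A n + L ⊎ a ≡ B n + L →
  Dominated k L (ZeroUpper L) (λ _ _ → ⊥) a b
zero-dominates-high {k} {L} {a} {b} {n} k≤L a≤b n≥1 a≡ with beatty-dominates ≤-refl k≤L (n≤1+n L) n≥1 a≤b a≡
... | inj₁ p = inj₁ (Sym-map {BeattyPair 1 L} {ZeroUpper L} inj₂ p)
... | inj₂ (inj₁ r) = inj₂ (inj₂ (Reach-map {Move k L} {Sym (BeattyPair 1 L)} (Sym-map {BeattyPair 1 L} {ZeroUpper L} inj₂) r))
... | inj₂ (inj₂ (a≡A , zero , _ , b≡a+0)) =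
  inj₂ (inj₂ (L , L , diagonal-move (A n) a≡L+A (trans b≡a+0 (trans (+-identityʳ a) a≡L+A)) (A-positive n≥1)
                        (subst (k ≤_) (sym (⊓-idem L)) k≤L) (subst (L ≤_) (sym (⊔-idem L)) ≤-refl) ,
              inj₁ (inj₁ (refl , ≤-refl))))
  where
  a≡L+A : a ≡ L + A n
  a≡L+A = trans a≡A (+-comm (A n) L)
... | inj₂ (inj₂ (_ , suc _ , s≤s () , _))

zero-dominates : ∀ {k L a b} → k ≤ L → a ≤ b → Dominated k L (ZeroUpper L) (λ _ _ → ⊥) a b
zero-dominates {k} {L} {a} {b} k≤L a≤b with a ≤? L
... | no a≰L with beatty-index (≰⇒> a≰L)
...   | n , n≥1 , a≡ = zero-dominates-high k≤L a≤b n≥1 a≡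
zero-dominates {k} {L} {a} {b} k≤L a≤b | yes a≤L with m≤n⇒m<n∨m≡n a≤b
... | inj₂ a≡b = inj₁ (inj₁ (inj₁ (a≡b , a≤L)))
... | inj₁ a<b = inj₂ (inj₂ (a , a , nimB a<b , inj₁ (inj₁ (refl , a≤L))))

value-zero : ∀ {k L} → k ≤ L → (g : ℕ → ℕ → ℕ) → IsNimValue k L g →
  ∀ a b → g a b ≡ 0 ⇔ Sym (ZeroUpper L) a b
value-zero {k} {L} k≤L g nim = level-set 0 (Sym (ZeroUpper L)) (independent ZeroUpper-scattered) (λ _ → z≤n) dominated
  where
  open LevelSet (Move k L) move-shrinks g nim
  dominated : ∀ a b → Sym (ZeroUpper L) a b ⊎ g a b < 0 ⊎ Reach (Move k L) (Sym (ZeroUpper L)) a b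
  dominated a b with dominated-everywhere {U = ZeroUpper L} {X = λ _ _ → ⊥} (λ ()) (zero-dominates k≤L) a b
  ... | inj₁ z = inj₁ z
  ... | inj₂ (inj₂ r) = inj₂ (inj₂ r)

SmallPairs : ℕ → ℕ → ℕ → Set
SmallPairs m a b = ∃[ i ] (i ≤ m × a ≡ 2 * i × b ≡ 2 * i + 1)

Centre : ℕ → ℕ → ℕ → Set
Centre m a b = a ≡ 2 * m + 1 + 1 × b ≡ 2 * m + 1 + 1

OneUpper : ℕ → ℕ → ℕ → Set
OneUpper m = SmallPairs m ∪ (Centre m ∪ BeattyPair 2 (2 * m))

small-below-centre : ∀ {m i} → i ≤ m → 2 * i + 1 < 2 * m + 1 + 1
small-below-centre {m} i≤m = +-monoˡ-< 1 (≤-<-trans (*-monoʳ-≤ 2 i≤m) (m<m+n (2 * m) z<s))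

centre-below-pairs : ∀ m → 2 * m + 1 + 1 < A 2 + 2 * m
centre-below-pairs m = ≤-reflexive (rearrange m)
  where
  rearrange : ∀ m → suc (2 * m + 1 + 1) ≡ 3 + 2 * m
  rearrange = solve-∀

SmallPairs-scattered : ∀ {m} → Scattered (2 * m + 1) (SmallPairs m)
SmallPairs-scattered {m} = record
  { ordered = λ { (i , _ , refl , refl) → m≤m+n (2 * i) 1 }
  ; same-lower = λ { (i , _ , refl , refl) (i′ , _ , eq , refl) → cong (λ j → 2 * j + 1) (*-cancelˡ-≡ i i′ 2 eq) }
  ; same-upper = λ { (i , _ , refl , refl) (i′ , _ , refl , eq) → cong (2 *_) (*-cancelˡ-≡ i i′ 2 (+-cancelʳ-≡ 1 _ _ eq)) }
  ; lower-upper = λ { (i , _ , refl , _) (i′ , _ , _ , eq) → ⊥-elim (even≢odd i i′ (trans eq (+-comm (2 * i′) 1))) }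
  ; same-offset = same-offset
  }
  where
  -- Only the last pair (2m, 2m + 1) reaches the threshold 2m + 1.
  same-offset : ∀ {a b s} → SmallPairs m a b → SmallPairs m (a + s) (b + s) → 2 * m + 1 ≤ a ⊔ b → s ≡ 0
  same-offset {s = s} (i , _ , refl , refl) (i′ , i′≤m , eq , _) L≤ =
    n≤0⇒n≡0 (+-cancelˡ-≤ (2 * i) s 0 (≤-trans (subst (_≤ 2 * m) (sym eq) (*-monoʳ-≤ 2 i′≤m))
                                                (subst (2 * m ≤_) (sym (+-identityʳ (2 * i))) 2m≤2i)))
    where
    2m≤2i : 2 * m ≤ 2 * i
    2m≤2i = +-cancelʳ-≤ 1 (2 * m) (2 * i) (subst (2 * m + 1 ≤_) (m≤n⇒m⊔n≡n (m≤m+n (2 * i) 1)) L≤)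

Centre-scattered : ∀ {m L} → Scattered L (Centre m)
Centre-scattered = record
  { ordered = λ (a≡ , b≡) → ≤-reflexive (trans a≡ (sym b≡))
  ; same-lower = λ (_ , b≡) (_ , b′≡) → trans b≡ (sym b′≡)
  ; same-upper = λ (a≡ , _) (a′≡ , _) → trans a≡ (sym a′≡)
  ; lower-upper = λ (_ , b≡) (b′≡ , _) → trans b≡ (sym b′≡)
  ; same-offset = λ {a} {b} {s} (a≡ , _) (a+s≡ , _) _ → +-cancelˡ-≡ a s 0 (trans a+s≡ (trans (sym a≡) (sym (+-identityʳ a))))
  }

-- Offsets are 1 on the small pairs, 0 at the centre and ≥ 2 on the translated pairs.
OneUpper-scattered : ∀ {m} → Scattered (2 * m + 1) (OneUpper m)
OneUpper-scattered {m} = Scattered-∪ SmallPairs-scattered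
  (Scattered-∪ (Centre-scattered {m}) (BeattyPair-scattered (s≤s z≤n)) centre-below centre-offsets)
  small-below small-offsets
  where
  centre-below : ∀ {a b a′ b′} → Centre m a b → BeattyPair 2 (2 * m) a′ b′ → b < a′
  centre-below (_ , refl) p = <-≤-trans (centre-below-pairs m) (pair-lower-bound p)
  centre-offsets : ∀ {a b s} → Centre m a b → BeattyPair 2 (2 * m) (a + s) (b + s) → ⊥
  centre-offsets {a} {b} {s} (a≡ , b≡) p =
    <⇒≱ (pair-offset-≥ p (trans (cong (_+ s) (trans b≡ (sym a≡))) (sym (+-identityʳ (a + s))))) z≤n
  small-below : ∀ {a b a′ b′} → SmallPairs m a b → (Centre m ∪ BeattyPair 2 (2 * m)) a′ b′ → b < a′
  small-below (i , i≤m , _ , refl) (inj₁ (refl , _)) = small-below-centre i≤m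
  small-below (i , i≤m , _ , refl) (inj₂ p) =
    <-trans (small-below-centre i≤m) (<-≤-trans (centre-below-pairs m) (pair-lower-bound p))
  small-offsets : ∀ {a b s} → SmallPairs m a b → (Centre m ∪ BeattyPair 2 (2 * m)) (a + s) (b + s) → ⊥
  small-offsets {s = s} (i , _ , refl , refl) (inj₁ (a≡ , b≡)) =
    <-irrefl (+-cancelʳ-≡ s _ _ (trans a≡ (sym b≡))) (≤-reflexive (+-comm 1 (2 * i)))
  small-offsets {s = s} (i , _ , refl , refl) (inj₂ p) =
    <⇒≱ (pair-offset-≥ p (regroup (2 * i) s)) ≤-refl
    where
    regroup : ∀ x s → x + 1 + s ≡ x + s + 1
    regroup = solve-∀

zero-one-disjoint : ∀ {m a b} → ZeroUpper (2 * m + 1) a b → OneUpper m a b → ⊥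
zero-one-disjoint (inj₁ (refl , _)) (inj₁ (i , _ , a≡ , b≡)) =
  <-irrefl (trans (sym a≡) b≡) (≤-reflexive (+-comm 1 (2 * i)))
zero-one-disjoint {m} (inj₁ (refl , a≤L)) (inj₂ (inj₁ (a≡ , _))) =
  <⇒≱ (≤-reflexive (trans (+-comm 1 (2 * m + 1)) (sym a≡))) a≤L
zero-one-disjoint {a = a} (inj₁ (refl , _)) (inj₂ (inj₂ p)) =
  <⇒≱ (pair-offset-≥ p (sym (+-identityʳ a))) z≤n
zero-one-disjoint {m} (inj₂ p) (inj₁ (i , i≤m , refl , _)) =
  <⇒≱ (≤-<-trans (*-monoʳ-≤ 2 i≤m) (m<m+n (2 * m) z<s)) (≤-trans (n≤1+n (2 * m + 1)) (pair-lower-bound p))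
zero-one-disjoint {a = a} (inj₂ p) (inj₂ (inj₁ (a≡ , b≡))) =
  <⇒≱ (pair-offset-≥ p (trans b≡ (trans (sym a≡) (sym (+-identityʳ a))))) z≤n
zero-one-disjoint {m} {a} (inj₂ p) (inj₂ (inj₂ q)) = <-irrefl L≡M (m<m+n (2 * m) z<s)
  where
  open BeattyPair
  same-index : index p ≡ index q
  same-index = +-cancelˡ-≡ a _ _ (trans (sym (pair-offset p)) (pair-offset q))
  L≡M : 2 * m ≡ 2 * m + 1
  L≡M = sym (+-cancelˡ-≡ (A (index p)) _ _
          (trans (sym (lower≡ p)) (trans (lower≡ q) (cong (λ i → A i + 2 * m) (sym same-index)))))

even-or-odd : ∀ a → ∃[ i ] (a ≡ 2 * i ⊎ a ≡ 2 * i + 1)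
even-or-odd zero = 0 , inj₁ refl
even-or-odd (suc a) with even-or-odd a
... | i , inj₁ refl = i , inj₂ (+-comm 1 (2 * i))
... | i , inj₂ refl = suc i , inj₁ (next i)
  where
  next : ∀ i → suc (2 * i + 1) ≡ 2 * suc i
  next = solve-∀

even-index : ∀ {i m} → 2 * i ≤ 2 * m + 1 → i ≤ m
even-index {i} {m} 2i≤ = ≮⇒≥ (λ m<i → <⇒≱ (subst (_≤ 2 * i) (double-suc m) (*-monoʳ-≤ 2 m<i)) 2i≤)
  where
  double-suc : ∀ m → 2 * suc m ≡ suc (2 * m + 1)
  double-suc = solve-∀

odd-index : ∀ {i m} → 2 * i + 1 ≤ 2 * m + 1 → i ≤ m
odd-index {i} {m} le = *-cancelˡ-≤ 2 (+-cancelʳ-≤ 1 (2 * i) (2 * m) le)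

OneDominated : ℕ → ℕ → ℕ → ℕ → Set
OneDominated k m = Dominated k (2 * m + 1) (OneUpper m) (Sym (ZeroUpper (2 * m + 1)))

one-dominates-low : ∀ {k m a b} → a ≤ b → a ≤ 2 * m + 1 → OneDominated k m a b
one-dominates-low {k} {m} {a} {b} a≤b a≤L with even-or-odd a
... | i , inj₁ refl with even-index {i} {m} a≤L | <-cmp b (2 * i + 1)
...   | i≤m | tri≈ _ b≡ _ = inj₁ (inj₁ (inj₁ (i , i≤m , refl , b≡)))
...   | i≤m | tri> _ _ b> = inj₂ (inj₂ (2 * i , 2 * i + 1 , nimB b> , inj₁ (inj₁ (i , i≤m , refl , refl))))
...   | i≤m | tri< b< _ _ = inj₂ (inj₁ (inj₁ (inj₁ (≤-antisym a≤b (≤-pred (subst (b <_) (+-comm (2 * i) 1) b<)) , a≤L))))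
one-dominates-low {k} {m} {a} {b} a≤b a≤L | i , inj₂ refl with m≤n⇒m<n∨m≡n a≤b
... | inj₂ a≡b = inj₂ (inj₁ (inj₁ (inj₁ (a≡b , a≤L))))
... | inj₁ a<b = inj₂ (inj₂ (2 * i + 1 , 2 * i , nimB (<-trans (m<m+n (2 * i) z<s) a<b) ,
                   inj₂ (inj₁ (i , odd-index {i} {m} a≤L , refl , refl))))

to-centre : ∀ {k m n} → k ≤ 2 * m → 2 ≤ n →
  Move k (2 * m + 1) (A n + 2 * m) (A n + 2 * m) (2 * m + 1 + 1) (2 * m + 1 + 1)
to-centre {k} {m} {n} k≤M n≥2 with m≤n⇒∃[o]m+o≡n (A-mono-≤ n≥2)
... | t , 3+t≡An = diagonal-move (suc t) a≡ a≡ z<s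
    (subst (k ≤_) (sym (⊓-idem (2 * m + 1 + 1))) (≤-trans k≤M (≤-trans (m≤m+n (2 * m) 1) (m≤m+n (2 * m + 1) 1))))
    (subst (2 * m + 1 ≤_) (sym (⊔-idem (2 * m + 1 + 1))) (m≤m+n (2 * m + 1) 1))
  where
  regroup : ∀ t m → 3 + t + 2 * m ≡ 2 * m + 1 + 1 + suc t
  regroup = solve-∀
  a≡ : A n + 2 * m ≡ 2 * m + 1 + 1 + suc t
  a≡ = trans (cong (_+ 2 * m) (sym 3+t≡An)) (regroup t m)

to-last-small : ∀ {k m n} → k ≤ 2 * m → 1 ≤ n →
  Move k (2 * m + 1) (A n + 2 * m) (A n + 2 * m + 1) (2 * m) (2 * m + 1)
to-last-small {k} {m} {n} k≤M n≥1 = diagonal-move (A n) (+-comm (A n) (2 * m)) (regroup (A n) m) (A-positive n≥1)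
  (⊓-glb k≤M (≤-trans k≤M (m≤m+n (2 * m) 1))) (m≤n⊔m (2 * m) (2 * m + 1))
  where
  regroup : ∀ x m → x + 2 * m + 1 ≡ 2 * m + 1 + x
  regroup = solve-∀

-- Values above c + 2 of A n + c and B n + c have index n ≥ 2, since A 1 = 1 and B 1 = 2.
index≥2 : ∀ {n c a} → 1 ≤ n → c + 2 < a → a ≡ A n + c ⊎ a ≡ B n + c → 2 ≤ n
index≥2 {suc (suc _)} _ _ _ = s≤s (s≤s z≤n)
index≥2 {suc zero} {c} _ big (inj₁ refl) = ⊥-elim (<⇒≱ big (≤-trans (n≤1+n (suc c)) (≤-reflexive (+-comm 2 c))))
index≥2 {suc zero} {c} _ big (inj₂ refl) = ⊥-elim (<⇒≱ big (≤-reflexive (+-comm 2 c)))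

-- Above the centre: the translated pairs of index ≥ 2, completed by the moves to the centre
-- (for b = a) and to (2m, 2m + 1) (for b = a + 1).
one-dominates-high : ∀ {k m a b n} → k ≤ 2 * m → a ≤ b → 2 ≤ n → a ≡ A n + 2 * m ⊎ a ≡ B n + 2 * m →
  OneDominated k m a b
one-dominates-high {k} {m} {a} {b} {n} k≤M a≤b n≥2 a≡
  with beatty-dominates (s≤s z≤n) k≤M (≤-reflexive (+-comm (2 * m) 1)) n≥2 a≤b a≡
... | inj₁ p = inj₁ (Sym-map {BeattyPair 2 (2 * m)} {OneUpper m} (λ p → inj₂ (inj₂ p)) p)
... | inj₂ (inj₁ r) = inj₂ (inj₂ (Reach-map {Move k (2 * m + 1)} {Sym (BeattyPair 2 (2 * m))}
                        (Sym-map {BeattyPair 2 (2 * m)} {OneUpper m} (λ p → inj₂ (inj₂ p))) r))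
... | inj₂ (inj₂ (refl , zero , _ , refl)) =
  inj₂ (inj₂ (c , c , subst (λ y → Move k (2 * m + 1) a y c c) (sym (+-identityʳ a)) (to-centre {k} {m} {n} k≤M n≥2) ,
              inj₁ (inj₂ (inj₁ (refl , refl)))))
  where
  c : ℕ
  c = 2 * m + 1 + 1
... | inj₂ (inj₂ (refl , suc zero , _ , refl)) =
  inj₂ (inj₂ (2 * m , 2 * m + 1 , to-last-small {k} {m} {n} k≤M (≤-trans (s≤s z≤n) n≥2) ,
              inj₁ (inj₁ (m , ≤-refl , refl , refl))))
... | inj₂ (inj₂ (_ , suc (suc _) , s≤s (s≤s ()) , _))

one-dominates-centre : ∀ {k m a b} → a ≡ 2 * m + 1 + 1 → a ≤ b → OneDominated k m a b
one-dominates-centre {a = a} a≡c a≤b with m≤n⇒m<n∨m≡n a≤b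
... | inj₂ a≡b = inj₁ (inj₁ (inj₂ (inj₁ (a≡c , trans (sym a≡b) a≡c))))
... | inj₁ a<b = inj₂ (inj₂ (a , a , nimB a<b , inj₁ (inj₂ (inj₁ (a≡c , a≡c)))))

one-dominates : ∀ {k m a b} → k ≤ 2 * m → a ≤ b → OneDominated k m a b
one-dominates {k} {m} {a} {b} k≤M a≤b with a ≤? 2 * m + 1
... | yes a≤L = one-dominates-low a≤b a≤L
... | no a≰L with m≤n⇒m<n∨m≡n (≰⇒> a≰L)
...   | inj₂ L+1≡a = one-dominates-centre (trans (sym L+1≡a) (+-comm 1 (2 * m + 1))) a≤b
...   | inj₁ L+1<a with beatty-index (<-trans (m<m+n (2 * m) z<s) (≰⇒> a≰L))
...     | n , n≥1 , a≡ = one-dominates-high k≤M a≤b (index≥2 n≥1 (subst (_< a) (sym (+-suc (2 * m) 1)) L+1<a) a≡) a≡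

value-one : ∀ {m k} → k ≤ 2 * m → (g : ℕ → ℕ → ℕ) → IsNimValue k (2 * m + 1) g →
  ∀ a b → g a b ≡ 1 ⇔ Sym (OneUpper m) a b
value-one {m} {k} k≤M g nim = level-set 1 (Sym (OneUpper m)) (independent OneUpper-scattered) nonzero dominated
  where
  open LevelSet (Move k (2 * m + 1)) move-shrinks g nim
  value-zero′ : ∀ a b → g a b ≡ 0 ⇔ Sym (ZeroUpper (2 * m + 1)) a b
  value-zero′ = value-zero (≤-trans k≤M (m≤m+n (2 * m) 1)) g nim

  nonzero : ∀ {a b} → Sym (OneUpper m) a b → 1 ≤ g a b
  nonzero {a} {b} o = n≢0⇒n>0 (λ g≡0 →
    Sym-disjoint (Scattered.ordered ZeroUpper-scattered) (Scattered.ordered OneUpper-scattered)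
      zero-one-disjoint (Equivalence.to (value-zero′ a b) g≡0) o)

  dominated : ∀ a b → Sym (OneUpper m) a b ⊎ g a b < 1 ⊎ Reach (Move k (2 * m + 1)) (Sym (OneUpper m)) a b
  dominated a b with dominated-everywhere (Sym-swap {ZeroUpper (2 * m + 1)}) (one-dominates k≤M) a b
  ... | inj₁ o = inj₁ o
  ... | inj₂ (inj₁ z) = inj₂ (inj₁ (≤-reflexive (cong suc (Equivalence.from (value-zero′ a b) z))))
  ... | inj₂ (inj₂ r) = inj₂ (inj₂ r)

shifted-after-B : ∀ {m n} → A (suc n) ≡ 1 + A n →
  A n + (2 * m + 1) ≡ A (suc n) + 2 * m × B n + (2 * m + 1) + 1 ≡ B (suc n) + 2 * m
shifted-after-B {m} {n} step rewrite step = lower (A n) m , upper (A n) n m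
  where
  lower : ∀ x m → x + (2 * m + 1) ≡ 1 + x + 2 * m
  lower = solve-∀
  upper : ∀ x n m → x + n + (2 * m + 1) + 1 ≡ 1 + x + suc n + 2 * m
  upper = solve-∀

shifted-after-A : ∀ {m n} → A (suc n) ≡ 2 + A n →
  A n + (2 * m + 1) + 1 ≡ A (suc n) + 2 * m × B n + (2 * m + 1) + 2 ≡ B (suc n) + 2 * m
shifted-after-A {m} {n} step rewrite step = lower (A n) m , upper (A n) n m
  where
  lower : ∀ x m → x + (2 * m + 1) + 1 ≡ 2 + x + 2 * m
  lower = solve-∀
  upper : ∀ x n m → x + n + (2 * m + 1) + 2 ≡ 2 + x + suc n + 2 * m
  upper = solve-∀

-- The candidate set for value 1 is the set of the theorem: a translated pair of index n + 1 ≥ 2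
-- splits according to whether n is a value of B (A steps by 1) or of A (A steps by 2).
OneUpper⇒InP1Set : ∀ {m a b} → OneUpper m a b → InP1Set m a b
OneUpper⇒InP1Set (inj₁ small) = inj₁ small
OneUpper⇒InP1Set (inj₂ (inj₁ centre)) = inj₂ (inj₁ centre)
OneUpper⇒InP1Set {m} (inj₂ (inj₂ (pair (suc n) (s≤s n≥1) a≡ b≡))) with complement n n≥1
... | inj₁ (j , j≥1 , refl) with shifted-after-A {m} {A j} (A-after-A {j} j≥1)
...   | lower , upper = inj₂ (inj₂ (inj₂ (j , A j , A (A j) , B (A j) , j≥1 ,
          IsFloorφ-A j , IsFloorφ-A (A j) , IsFloorφ²-B (A j) , trans a≡ (sym lower) , trans b≡ (sym upper))))
OneUpper⇒InP1Set {m} (inj₂ (inj₂ (pair (suc n) (s≤s n≥1) a≡ b≡))) | inj₂ (j , j≥1 , refl) with shifted-after-B {m} {B j} (A-after-B {j} j≥1)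
... | lower , upper = inj₂ (inj₂ (inj₁ (j , B j , A (B j) , B (B j) , j≥1 ,
        IsFloorφ²-B j , IsFloorφ-A (B j) , IsFloorφ²-B (B j) , trans a≡ (sym lower) , trans b≡ (sym upper))))

InP1Set⇒OneUpper : ∀ {m a b} → InP1Set m a b → OneUpper m a b
InP1Set⇒OneUpper (inj₁ small) = inj₁ small
InP1Set⇒OneUpper (inj₂ (inj₁ centre)) = inj₂ (inj₁ centre)
InP1Set⇒OneUpper {m} (inj₂ (inj₂ (inj₁ (j , n , x , y , j≥1 , fn , fx , fy , a≡ , b≡))))
  with IsFloorφ²⇒≡B {j} fn | IsFloorφ⇒≡A {n} fx | IsFloorφ²⇒≡B {n} fy
... | refl | refl | refl with shifted-after-B {m} {B j} (A-after-B {j} j≥1)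
...   | lower , upper = inj₂ (inj₂ (pair (suc n) (s≤s (≤-trans j≥1 (m≤n+m j (A j)))) (trans a≡ lower) (trans b≡ upper)))
InP1Set⇒OneUpper {m} (inj₂ (inj₂ (inj₂ (j , n , x , y , j≥1 , fn , fx , fy , a≡ , b≡))))
  with IsFloorφ⇒≡A {j} fn | IsFloorφ⇒≡A {n} fx | IsFloorφ²⇒≡B {n} fy
... | refl | refl | refl with shifted-after-A {m} {A j} (A-after-A {j} j≥1)
...   | lower , upper = inj₂ (inj₂ (pair (suc n) (s≤s (A-positive j≥1)) (trans a≡ lower) (trans b≡ upper)))

theorem7 : (m k : ℕ) → k < 2 * m + 1 →
    (g : ℕ → ℕ → ℕ) → IsNimValue k (2 * m + 1) g →
    ∀ a b → a ≤ b → (g a b ≡ 1 ⇔ InP1Set m a b)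
theorem7 m k k<L g nim a b a≤b = upper-part ⇔-∘ value-one k≤2m g nim a b
  where
  k≤2m : k ≤ 2 * m
  k≤2m = +-cancelʳ-≤ 1 k (2 * m) (subst (_≤ 2 * m + 1) (+-comm 1 k) k<L)
  upper-part : Sym (OneUpper m) a b ⇔ InP1Set m a b
  upper-part = mk⇔ (OneUpper⇒InP1Set ∘ Sym-upper (Scattered.ordered OneUpper-scattered) a≤b) (inj₁ ∘ InP1Set⇒OneUpper)
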